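{- Given a forest on $n$ vertices, after performing $\lceil \log_{6/5} \log n \rceil$ rounds of maximal tree contraction, the number of vertices in the resulting forest is at most $n / \log n$.
   Context: Maximal tree contraction proceeds in rounds. In each round, on the current forest, a maximal independent set of the vertices of degree one or two (maximal within the subgraph induced by those vertices) is contracted: degree-one vertices are raked (removed) and degree-two vertices are compressed (removed, with their two incident edges replaced by one edge joining their two neighbors); isolated vertices (degree zero) finalize and are removed. -}

module Defs where

open import Data.Nat using (ℕ; zero; suc; _≤_; _<_; _^_; _≡ᵇ_)
open import Data.Bool using (Bool; true; false; _∧_; _∨_; not; if_then_else_)
open import Data.Fin using (Fin; _≟_)
open import Data.List using (List; []; _∷_; _++_; [_]; length; map; allFin)
open import Data.Nat.ListAction using (sum)
open import Data.Bool.ListAction using (any)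
open import Data.List.Relation.Unary.All using (All)
open import Data.List.Relation.Unary.Linked using (Linked)
open import Data.List.Relation.Unary.Unique.Propositional using (Unique)
open import Data.Product using (Σ; _×_; ∃)
open import Relation.Nullary using (¬_)
open import Relation.Nullary.Decidable using (⌊_⌋)
open import Relation.Binary.PropositionalEquality using (_≡_)

-- A (current) graph whose vertices are drawn from Fin n: `alive v` says
-- whether v is still a vertex; `adj u w` is the edge relation.
record Graph (n : ℕ) : Set where
  field
    alive : Fin n → Bool
    adj   : Fin n → Fin n → Bool
open Graph public

cnt : ∀ {n} → (Fin n → Bool) → ℕ
cnt {n} p = sum (map (λ i → if p i then 1 else 0) (allFin n))

size : ∀ {n} → Graph n → ℕ
size G = cnt (alive G)

deg : ∀ {n} → Graph n → Fin n → ℕ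
deg G v = cnt (λ w → alive G w ∧ adj G v w)

WellFormed : ∀ {n} → Graph n → Set
WellFormed G =
  (∀ u w → adj G u w ≡ true → adj G w u ≡ true) ×
  (∀ u → adj G u u ≡ false) ×
  (∀ u w → adj G u w ≡ true → alive G u ≡ true)

IsCycle : ∀ {n} → Graph n → Fin n → List (Fin n) → Set
IsCycle G v vs =
  2 ≤ length vs ×
  Unique (v ∷ vs) ×
  All (λ u → alive G u ≡ true) (v ∷ vs) ×
  Linked (λ u w → adj G u w ≡ true) (v ∷ vs ++ [ v ])

IsForest : ∀ {n} → Graph n → Set
IsForest G = WellFormed G × (∀ v vs → ¬ IsCycle G v vs)

Candidate : ∀ {n} → Graph n → Fin n → Bool
Candidate G v = alive G v ∧ ((deg G v ≡ᵇ 1) ∨ (deg G v ≡ᵇ 2))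

IsMIS : ∀ {n} → Graph n → (Fin n → Bool) → Set
IsMIS G S =
  (∀ v → S v ≡ true → Candidate G v ≡ true) ×
  (∀ u v → S u ≡ true → S v ≡ true → adj G u v ≡ false) ×
  (∀ v → Candidate G v ≡ true → S v ≡ false →
     ∃ λ u → S u ≡ true × adj G v u ≡ true)

-- One contraction step w.r.t. S: vertices of S are raked (degree 1) or
-- compressed (degree 2, their two neighbours become adjacent); isolated
-- vertices are finalized and removed.
contract : ∀ {n} → Graph n → (Fin n → Bool) → Graph n
contract {n} G S = record { alive = alive' ; adj = adj' }
  where
  alive' : Fin n → Bool
  alive' v = alive G v ∧ not (S v) ∧ not (deg G v ≡ᵇ 0)
  adj' : Fin n → Fin n → Bool
  adj' u w = alive' u ∧ alive' w ∧
    (adj G u w ∨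
     (not ⌊ u ≟ w ⌋ ∧
      any (λ v → S v ∧ (deg G v ≡ᵇ 2) ∧ adj G v u ∧ adj G v w) (allFin n)))

data Rounds {n : ℕ} : ℕ → Graph n → Graph n → Set where
  done : ∀ {G} → Rounds zero G G
  step : ∀ {k G G'} (S : Fin n → Bool) → IsMIS G S →
         Rounds k (contract G S) G' → Rounds (suc k) G G'

-- k = ⌈ log_{6/5} (log₂ n) ⌉, for n ≥ 2, stated in integer arithmetic:
--   log_{6/5} log₂ n ≤ k   ⇔  n ^ (5^k) ≤ 2 ^ (6^k)
--   k - 1 < log_{6/5} log₂ n ⇔ 2 ^ (6^(k-1)) < n ^ (5^(k-1))   (k ≥ 1;
--   automatic for k = 0 since log₂ n ≥ 1 > 5/6)
IsCeilLogLog : ℕ → ℕ → Set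
IsCeilLogLog n zero    = n ^ (5 ^ 0) ≤ 2 ^ (6 ^ 0)
IsCeilLogLog n (suc j) = n ^ (5 ^ suc j) ≤ 2 ^ (6 ^ suc j) × 2 ^ (6 ^ j) < n ^ (5 ^ j)

-- m ≤ n / log₂ n  ⇔  m · log₂ n ≤ n  ⇔  n ^ m ≤ 2 ^ n   (n ≥ 2)
AtMostNOverLog : ℕ → ℕ → Set
AtMostNOverLog m n = n ^ m ≤ 2 ^ n

-- Call a graph a pseudoforest when every set of m vertices spans at most m edges. A forest is
-- one: each nonempty vertex set has a vertex with at most one neighbour inside it (otherwise a
-- non-backtracking walk closes a cycle), and removing that vertex gives an induction. One round of
-- contraction keeps the property, because an edge created by compressing s is paid for by the two
-- edges from s. In a pseudoforest with V vertices, I of them isolated, the degree sum is at most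
-- 2(V − I); as every other vertex has degree one, two or at least three, at least (V − I)/2
-- vertices have degree one or two. Each vertex of the maximal independent set dominates at most
-- three of them, so a round removes at least (V − I)/6 + I ≥ V/6 vertices. Hence k rounds leave at
-- most (5/6)^k n vertices, which is at most n / log₂ n as soon as n^(5^k) ≤ 2^(6^k).

module Submission where

open import Defs

open import Data.Nat hiding (_≟_)
import Data.Nat.ListAction as List
open import Data.Nat.Properties hiding (_≟_)
open import Data.Nat.Tactic.RingSolver using (solve-∀)
open import Algebra.Properties.Semiring.Sum +-*-semiring
  using (sum; sum-syntax; sum-cong-≗; ∑-distrib-+; ∑-comm; sum-replicate-zero; *-distribˡ-sum; *-distribʳ-sum)
open import Data.Bool using (Bool; true; false; _∧_; _∨_; not; if_then_else_)
import Data.Bool.Properties as Bool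
open import Data.Bool.ListAction using (any; or)
open import Data.Empty using (⊥; ⊥-elim)
open import Data.Fin using (Fin; zero; suc; _≟_)
import Data.Fin.Properties as Fin
open import Data.List using (List; []; _∷_; _++_; [_]; tabulate; allFin)
open import Data.List.Properties using (++-assoc; map-tabulate; map-cong)
open import Data.List.Membership.Propositional using (_∈_; _∉_)
open import Data.List.Membership.Propositional.Properties using (∈-∃++)
open import Data.List.Relation.Unary.All as All using (All; []; _∷_)
import Data.List.Relation.Unary.All.Properties as All
open import Data.List.Relation.Unary.AllPairs using ([]; _∷_)
open import Data.List.Relation.Unary.Any using (here; there; satisfied)
open import Data.List.Relation.Unary.Any.Properties using (any⁻)
open import Data.List.Relation.Unary.Linked using (Linked; []; [-]; _∷_)
open import Data.List.Relation.Unary.Unique.Propositional using (Unique)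
open import Data.Product using (_×_; _,_; ∃; proj₁; proj₂)
open import Function using (_∘_; id; case_of_)
open import Function.Bundles using (Equivalence)
open import Relation.Binary.PropositionalEquality hiding ([_])
open import Relation.Nullary using (¬_; Dec; yes; no)
open import Relation.Nullary.Decidable using (⌊_⌋; ⌊⌋-map′; _×-dec_)

χ : Bool → ℕ
χ b = if b then 1 else 0

χ-∧ : ∀ a b → χ (a ∧ b) ≡ χ a * χ b
χ-∧ true  b = sym (+-identityʳ (χ b))
χ-∧ false b = refl

χ-∨ : ∀ a b → a ∧ b ≡ false → χ (a ∨ b) ≡ χ a + χ b
χ-∨ true  false _ = refl
χ-∨ false b     _ = refl

χ-∨-∧ : ∀ a b e → a ∧ b ≡ false → χ ((a ∨ b) ∧ e) ≡ χ (a ∧ e) + χ (b ∧ e)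
χ-∨-∧ true  true  e ()
χ-∨-∧ true  false e _ = sym (+-identityʳ _)
χ-∨-∧ false b     e _ = refl

χ-*-≤ : ∀ a {c} → (a ≡ true → c ≤ 1) → χ a * c ≤ χ a
χ-*-≤ true  c≤1 = ≤-trans (≤-reflexive (+-identityʳ _)) (c≤1 refl)
χ-*-≤ false _   = z≤n

∧-true : ∀ {a b} → a ∧ b ≡ true → a ≡ true × b ≡ true
∧-true {true} b≡true = refl , b≡true

not⌊⌋⇒¬ : ∀ {P : Set} (d : Dec P) → not ⌊ d ⌋ ≡ true → ¬ P
not⌊⌋⇒¬ (no ¬p) _ = ¬p

¬⇒not⌊⌋ : ∀ {P : Set} (d : Dec P) → ¬ P → not ⌊ d ⌋ ≡ true
¬⇒not⌊⌋ (yes p) ¬p = ⊥-elim (¬p p)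
¬⇒not⌊⌋ (no _)  _  = refl

≡ᵇ-true⇒≡ : ∀ {m k} → (m ≡ᵇ k) ≡ true → m ≡ k
≡ᵇ-true⇒≡ {m} {k} m≡ᵇk = ≡ᵇ⇒≡ m k (Equivalence.from Bool.T-≡ m≡ᵇk)

≡⇒≡ᵇ-true : ∀ {m k} → m ≡ k → (m ≡ᵇ k) ≡ true
≡⇒≡ᵇ-true {m} {k} m≡k = Equivalence.to Bool.T-≡ (≡⇒≡ᵇ m k m≡k)

≥1⇒≢ᵇ0 : ∀ {d} → 1 ≤ d → (d ≡ᵇ 0) ≡ false
≥1⇒≢ᵇ0 (s≤s _) = refl

⌊≟⌋-sym : ∀ {n} (u w : Fin n) → ⌊ u ≟ w ⌋ ≡ ⌊ w ≟ u ⌋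
⌊≟⌋-sym u w with u ≟ w | w ≟ u
... | yes _   | yes _   = refl
... | no  _   | no  _   = refl
... | yes u≡w | no  w≢u = ⊥-elim (w≢u (sym u≡w))
... | no  u≢w | yes w≡u = ⊥-elim (u≢w (sym w≡u))

any-witness : ∀ {A : Set} (p : A → Bool) xs → any p xs ≡ true → ∃ λ x → p x ≡ true
any-witness p xs any≡true with x , px ← satisfied (any⁻ p xs (Equivalence.from Bool.T-≡ any≡true)) =
  x , Equivalence.to Bool.T-≡ px

sum-mono-≤ : ∀ {n} {f g : Fin n → ℕ} → (∀ i → f i ≤ g i) → sum f ≤ sum g
sum-mono-≤ {zero}  f≤g = z≤n
sum-mono-≤ {suc n} f≤g = +-mono-≤ (f≤g zero) (sum-mono-≤ (f≤g ∘ suc))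

term≤sum : ∀ {n} (f : Fin n → ℕ) i → f i ≤ sum f
term≤sum f zero    = m≤m+n _ _
term≤sum f (suc i) = ≤-trans (term≤sum (f ∘ suc) i) (m≤n+m _ _)

two-terms≤sum : ∀ {n} (f : Fin n → ℕ) {i j} → i ≢ j → f i + f j ≤ sum f
two-terms≤sum f {zero}  {zero}  i≢j = ⊥-elim (i≢j refl)
two-terms≤sum f {zero}  {suc j} _   = +-monoʳ-≤ (f zero) (term≤sum (f ∘ suc) j)
two-terms≤sum f {suc i} {zero}  _   =
  ≤-trans (≤-reflexive (+-comm (f (suc i)) (f zero))) (+-monoʳ-≤ (f zero) (term≤sum (f ∘ suc) i))
two-terms≤sum f {suc i} {suc j} i≢j =
  ≤-trans (two-terms≤sum (f ∘ suc) (i≢j ∘ cong suc)) (m≤n+m _ (f zero))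

sum-δ : ∀ {n} (v : Fin n) (f : Fin n → ℕ) → ∑[ u < n ] (χ ⌊ v ≟ u ⌋ * f u) ≡ f v
sum-δ {suc n} zero f = begin
  f zero + 0 + ∑[ u < n ] 0   ≡⟨ cong (f zero + 0 +_) (sum-replicate-zero n) ⟩
  f zero + 0 + 0              ≡⟨ +-identityʳ _ ⟩
  f zero + 0                  ≡⟨ +-identityʳ _ ⟩
  f zero                      ∎
  where open ≡-Reasoning
sum-δ {suc n} (suc v) f = begin
  ∑[ u < n ] (χ ⌊ suc v ≟ suc u ⌋ * f (suc u))
    ≡⟨ sum-cong-≗ (λ u → cong (λ b → χ b * f (suc u)) (⌊⌋-map′ _ _ (v ≟ u))) ⟩
  ∑[ u < n ] (χ ⌊ v ≟ u ⌋ * f (suc u))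
    ≡⟨ sum-δ v (f ∘ suc) ⟩
  f (suc v) ∎
  where open ≡-Reasoning

-- Finite vertex sets

module _ {n : ℕ} where

  card : (Fin n → Bool) → ℕ
  card X = ∑[ v < n ] χ (X v)

  _∪_ : (Fin n → Bool) → (Fin n → Bool) → Fin n → Bool
  (X ∪ Y) v = X v ∨ Y v

  ｛_｝ : Fin n → Fin n → Bool
  ｛ v ｝ w = ⌊ v ≟ w ⌋

  _─_ : (Fin n → Bool) → Fin n → Fin n → Bool
  (X ─ v) w = not ⌊ v ≟ w ⌋ ∧ X w

  _⊆_ : (Fin n → Bool) → (Fin n → Bool) → Set
  X ⊆ Y = ∀ v → X v ≡ true → Y v ≡ true

  Disjoint : (Fin n → Bool) → (Fin n → Bool) → Set
  Disjoint X Y = ∀ v → X v ∧ Y v ≡ false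

  cnt≡card : (X : Fin n → Bool) → cnt X ≡ card X
  cnt≡card X = trans (cong List.sum (map-tabulate id (χ ∘ X))) (sum-tabulate (χ ∘ X))
    where
    sum-tabulate : ∀ {m} (f : Fin m → ℕ) → List.sum (tabulate f) ≡ sum f
    sum-tabulate {zero}  f = refl
    sum-tabulate {suc m} f = cong (f zero +_) (sum-tabulate (f ∘ suc))

  card-mono : ∀ {X Y} → X ⊆ Y → card X ≤ card Y
  card-mono {X} {Y} X⊆Y = sum-mono-≤ χ-mono
    where
    χ-mono : ∀ v → χ (X v) ≤ χ (Y v)
    χ-mono v with X v in Xv
    ... | false = z≤n
    ... | true  rewrite X⊆Y v Xv = ≤-refl

  card-∪ : ∀ X Y → Disjoint X Y → card (X ∪ Y) ≡ card X + card Y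
  card-∪ X Y X∩Y=∅ =
    trans (sum-cong-≗ (λ v → χ-∨ (X v) (Y v) (X∩Y=∅ v))) (∑-distrib-+ (χ ∘ X) (χ ∘ Y))

  card-｛｝ : ∀ v → card ｛ v ｝ ≡ 1
  card-｛｝ v = trans (sum-cong-≗ (λ w → sym (*-identityʳ (χ ⌊ v ≟ w ⌋)))) (sum-δ v (λ _ → 1))

  ─-∪-｛｝ : ∀ {X v} → X v ≡ true → ∀ w → X w ≡ ((X ─ v) ∪ ｛ v ｝) w
  ─-∪-｛｝ {X} {v} Xv w with v ≟ w
  ... | yes refl = Xv
  ... | no  _    = sym (Bool.∨-identityʳ (X w))

  ─-disjoint-｛｝ : ∀ X v → Disjoint (X ─ v) ｛ v ｝
  ─-disjoint-｛｝ X v w with ⌊ v ≟ w ⌋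
  ... | true  = refl
  ... | false = Bool.∧-zeroʳ (X w)

  card-remove : ∀ {X v} → X v ≡ true → card X ≡ suc (card (X ─ v))
  card-remove {X} {v} Xv = begin
    card X                     ≡⟨ sum-cong-≗ (cong χ ∘ ─-∪-｛｝ {X = X} Xv) ⟩
    card ((X ─ v) ∪ ｛ v ｝)    ≡⟨ card-∪ (X ─ v) ｛ v ｝ (─-disjoint-｛｝ X v) ⟩
    card (X ─ v) + card ｛ v ｝ ≡⟨ cong (card (X ─ v) +_) (card-｛｝ v) ⟩
    card (X ─ v) + 1           ≡⟨ +-comm (card (X ─ v)) 1 ⟩
    suc (card (X ─ v))         ∎
    where open ≡-Reasoning

card>0⇒nonempty : ∀ {n} {X : Fin n → Bool} → 1 ≤ card X → ∃ λ v → X v ≡ true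
card>0⇒nonempty {suc n} {X} 1≤card with X zero in X0
... | true  = zero , X0
... | false with card>0⇒nonempty {n} {X ∘ suc} 1≤card
...   | v , Xv = suc v , Xv

card≥2⇒∃≢ : ∀ {n} {X : Fin n → Bool} → 2 ≤ card X → ∀ y → ∃ λ w → X w ≡ true × w ≢ y
card≥2⇒∃≢ {n} {X} 2≤card y with X y in Xy
... | true with card>0⇒nonempty {X = X ─ y} (s≤s⁻¹ (subst (2 ≤_) (card-remove {X = X} Xy) 2≤card))
...   | w , y≠w∧Xw = w , proj₂ (∧-true y≠w∧Xw) , (λ w≡y → not⌊⌋⇒¬ (y ≟ w) (proj₁ (∧-true y≠w∧Xw)) (sym w≡y))
card≥2⇒∃≢ {n} {X} 2≤card y | false with card>0⇒nonempty {X = X} (≤-trans (n≤1+n 1) 2≤card)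
... | w , Xw = w , Xw , λ { refl → case trans (sym Xw) Xy of λ () }

card-full : ∀ {n} → card {n} (λ _ → true) ≡ n
card-full {zero}  = refl
card-full {suc n} = cong suc (card-full {n})

-- Neighbourhood counts

module _ {n : ℕ} (G : Graph n) where

  nbrs : (Fin n → Bool) → Fin n → ℕ
  nbrs B v = card (λ w → B w ∧ adj G v w)

  between : (Fin n → Bool) → (Fin n → Bool) → ℕ
  between A B = ∑[ u < n ] (χ (A u) * nbrs B u)

  arcs : (Fin n → Bool) → ℕ
  arcs X = between X X

  -- arcs counts every edge twice, so no vertex set spans more edges than it has vertices.
  Pseudoforest : Set
  Pseudoforest = ∀ X → X ⊆ alive G → arcs X ≤ 2 * card X

  Isolated NonIsolated : Fin n → Bool
  Isolated    v = alive G v ∧ (deg G v ≡ᵇ 0)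
  NonIsolated v = alive G v ∧ not (deg G v ≡ᵇ 0)

module _ {n : ℕ} (G : Graph n) where

  deg≡nbrs-alive : ∀ v → deg G v ≡ nbrs G (alive G) v
  deg≡nbrs-alive v = cnt≡card (λ w → alive G w ∧ adj G v w)

  nbrs-mono : ∀ {A B} v → (∀ w → adj G v w ≡ true → A w ≡ true → B w ≡ true) → nbrs G A v ≤ nbrs G B v
  nbrs-mono {A} {B} v A⊆B-near-v = card-mono A∧adj⊆B∧adj
    where
    A∧adj⊆B∧adj : (λ w → A w ∧ adj G v w) ⊆ (λ w → B w ∧ adj G v w)
    A∧adj⊆B∧adj w Aw∧adj with ∧-true {A w} Aw∧adj
    ... | Aw , v~w rewrite A⊆B-near-v w v~w Aw | v~w = refl

  nbrs≤card : ∀ B v → nbrs G B v ≤ card B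
  nbrs≤card B v = card-mono {Y = B} (λ w B∧adj → proj₁ (∧-true B∧adj))

  nbrs-∪ : ∀ A B → Disjoint A B → ∀ v → nbrs G (A ∪ B) v ≡ nbrs G A v + nbrs G B v
  nbrs-∪ A B A∩B=∅ v = trans
    (sum-cong-≗ (λ w → χ-∨-∧ (A w) (B w) (adj G v w) (A∩B=∅ w)))
    (∑-distrib-+ (λ w → χ (A w ∧ adj G v w)) (λ w → χ (B w ∧ adj G v w)))

  between-∪ˡ : ∀ A B C → Disjoint A B → between G (A ∪ B) C ≡ between G A C + between G B C
  between-∪ˡ A B C A∩B=∅ = trans
    (sum-cong-≗ (λ u → trans (cong (_* nbrs G C u) (χ-∨ (A u) (B u) (A∩B=∅ u)))
                             (*-distribʳ-+ (nbrs G C u) (χ (A u)) (χ (B u)))))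
    (∑-distrib-+ (λ u → χ (A u) * nbrs G C u) (λ u → χ (B u) * nbrs G C u))

  between-∪ʳ : ∀ A B C → Disjoint B C → between G A (B ∪ C) ≡ between G A B + between G A C
  between-∪ʳ A B C B∩C=∅ = trans
    (sum-cong-≗ (λ u → trans (cong (χ (A u) *_) (nbrs-∪ B C B∩C=∅ u))
                             (*-distribˡ-+ (χ (A u)) (nbrs G B u) (nbrs G C u))))
    (∑-distrib-+ (λ u → χ (A u) * nbrs G B u) (λ u → χ (A u) * nbrs G C u))

  between-｛｝ˡ : ∀ v B → between G ｛ v ｝ B ≡ nbrs G B v
  between-｛｝ˡ v B = sum-δ v (nbrs G B)

  between-regular : ∀ {A B} k → (∀ u → A u ≡ true → nbrs G B u ≡ k) → between G A B ≡ k * card A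
  between-regular {A} {B} k regular = begin
    ∑[ u < n ] (χ (A u) * nbrs G B u) ≡⟨ sum-cong-≗ term ⟩
    ∑[ u < n ] (k * χ (A u))          ≡⟨ *-distribˡ-sum k (χ ∘ A) ⟨
    k * card A                        ∎
    where
    open ≡-Reasoning
    term : ∀ u → χ (A u) * nbrs G B u ≡ k * χ (A u)
    term u with A u in Au
    ... | false = sym (*-zeroʳ k)
    ... | true  = trans (+-identityʳ _) (trans (regular u Au) (sym (*-identityʳ k)))

  between-bounded : ∀ {A B} k → (∀ u → A u ≡ true → nbrs G B u ≤ k) → between G A B ≤ k * card A
  between-bounded {A} {B} k bounded = begin
    ∑[ u < n ] (χ (A u) * nbrs G B u) ≤⟨ sum-mono-≤ term ⟩
    ∑[ u < n ] (k * χ (A u))          ≡⟨ *-distribˡ-sum k (χ ∘ A) ⟨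
    k * card A                        ∎
    where
    open ≤-Reasoning
    term : ∀ u → χ (A u) * nbrs G B u ≤ k * χ (A u)
    term u with A u in Au
    ... | false = z≤n
    ... | true  = ≤-trans (≤-reflexive (+-identityʳ _)) (≤-trans (bounded u Au) (≤-reflexive (sym (*-identityʳ k))))

  between≤card*card : ∀ A B → between G A B ≤ card A * card B
  between≤card*card A B = begin
    ∑[ u < n ] (χ (A u) * nbrs G B u) ≤⟨ sum-mono-≤ (λ u → *-monoʳ-≤ (χ (A u)) (nbrs≤card B u)) ⟩
    ∑[ u < n ] (χ (A u) * card B)     ≡⟨ *-distribʳ-sum (card B) (χ ∘ A) ⟨
    card A * card B                   ∎
    where open ≤-Reasoning

  between-cong : ∀ {A A' B B'} → A ≗ A' → B ≗ B' → between G A B ≡ between G A' B'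
  between-cong A≗A' B≗B' = sum-cong-≗ λ u →
    cong₂ _*_ (cong χ (A≗A' u)) (sum-cong-≗ λ w → cong (λ b → χ (b ∧ adj G u w)) (B≗B' w))

module WellFormedGraph {n : ℕ} {G : Graph n} (wf : WellFormed G) where

  adj-sym : ∀ {u w} → adj G u w ≡ true → adj G w u ≡ true
  adj-sym = proj₁ wf _ _

  adj-irrefl : ∀ u → adj G u u ≡ false
  adj-irrefl = proj₁ (proj₂ wf)

  adj⇒aliveˡ : ∀ {u w} → adj G u w ≡ true → alive G u ≡ true
  adj⇒aliveˡ = proj₂ (proj₂ wf) _ _

  adj⇒aliveʳ : ∀ {u w} → adj G u w ≡ true → alive G w ≡ true
  adj⇒aliveʳ = adj⇒aliveˡ ∘ adj-sym

  adj-comm : ∀ u w → adj G u w ≡ adj G w u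
  adj-comm u w with adj G u w in uw | adj G w u in wu
  ... | true  | true  = refl
  ... | false | false = refl
  ... | true  | false = trans (sym (adj-sym uw)) wu
  ... | false | true  = trans (sym uw) (adj-sym wu)

  adj⇒nonIsolated : ∀ {u w} → adj G u w ≡ true → NonIsolated G w ≡ true
  adj⇒nonIsolated {u} {w} u~w rewrite adj⇒aliveʳ u~w = cong not (≥1⇒≢ᵇ0 deg≥1)
    where
    u~w-counted : χ (alive G u ∧ adj G w u) ≡ 1
    u~w-counted rewrite adj⇒aliveˡ u~w | adj-sym u~w = refl
    deg≥1 : 1 ≤ deg G w
    deg≥1 = subst (1 ≤_) (sym (deg≡nbrs-alive G w))
      (subst (_≤ nbrs G (alive G) w) u~w-counted (term≤sum (λ x → χ (alive G x ∧ adj G w x)) u))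

  between-comm : ∀ A B → between G A B ≡ between G B A
  between-comm A B = begin
    ∑[ u < n ] (χ (A u) * ∑[ w < n ] χ (B w ∧ adj G u w))   ≡⟨ sum-cong-≗ (λ u → *-distribˡ-sum (χ (A u)) (λ w → χ (B w ∧ adj G u w))) ⟩
    ∑[ u < n ] ∑[ w < n ] (χ (A u) * χ (B w ∧ adj G u w))   ≡⟨ ∑-comm (λ u w → χ (A u) * χ (B w ∧ adj G u w)) ⟩
    ∑[ w < n ] ∑[ u < n ] (χ (A u) * χ (B w ∧ adj G u w))   ≡⟨ sum-cong-≗ (λ w → sum-cong-≗ (λ u → swap u w)) ⟩
    ∑[ w < n ] ∑[ u < n ] (χ (B w) * χ (A u ∧ adj G w u))   ≡⟨ sum-cong-≗ (λ w → *-distribˡ-sum (χ (B w)) (λ u → χ (A u ∧ adj G w u))) ⟨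
    ∑[ w < n ] (χ (B w) * ∑[ u < n ] χ (A u ∧ adj G w u))   ∎
    where
    open ≡-Reasoning
    χ-swap : ∀ a b e → χ a * χ (b ∧ e) ≡ χ b * χ (a ∧ e)
    χ-swap true  true  e = refl
    χ-swap true  false e = refl
    χ-swap false true  e = refl
    χ-swap false false e = refl
    swap : ∀ u w → χ (A u) * χ (B w ∧ adj G u w) ≡ χ (B w) * χ (A u ∧ adj G w u)
    swap u w rewrite adj-comm u w = χ-swap (A u) (B w) (adj G w u)

  arcs-∪ : ∀ A B → Disjoint A B → arcs G (A ∪ B) ≡ arcs G A + 2 * between G A B + arcs G B
  arcs-∪ A B A∩B=∅ = begin
    between G (A ∪ B) (A ∪ B)
      ≡⟨ between-∪ˡ G A B (A ∪ B) A∩B=∅ ⟩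
    between G A (A ∪ B) + between G B (A ∪ B)
      ≡⟨ cong₂ _+_ (between-∪ʳ G A A B A∩B=∅) (between-∪ʳ G B A B A∩B=∅) ⟩
    (arcs G A + between G A B) + (between G B A + arcs G B)
      ≡⟨ cong (λ x → arcs G A + between G A B + (x + arcs G B)) (between-comm B A) ⟩
    (arcs G A + between G A B) + (between G A B + arcs G B)
      ≡⟨ rearrange (arcs G A) (between G A B) (arcs G B) ⟩
    arcs G A + 2 * between G A B + arcs G B ∎
    where
    open ≡-Reasoning
    rearrange : ∀ a b c → (a + b) + (b + c) ≡ a + 2 * b + c
    rearrange = solve-∀

  nbrs-｛｝-self : ∀ v → nbrs G ｛ v ｝ v ≡ 0
  nbrs-｛｝-self v = begin
    ∑[ w < n ] χ (⌊ v ≟ w ⌋ ∧ adj G v w)     ≡⟨ sum-cong-≗ (λ w → χ-∧ ⌊ v ≟ w ⌋ (adj G v w)) ⟩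
    ∑[ w < n ] (χ ⌊ v ≟ w ⌋ * χ (adj G v w)) ≡⟨ sum-δ v (χ ∘ adj G v) ⟩
    χ (adj G v v)                            ≡⟨ cong χ (adj-irrefl v) ⟩
    0                                        ∎
    where open ≡-Reasoning

  arcs-remove : ∀ {X v} → X v ≡ true → arcs G X ≡ arcs G (X ─ v) + 2 * nbrs G (X ─ v) v
  arcs-remove {X} {v} Xv = begin
    arcs G X
      ≡⟨ between-cong G (─-∪-｛｝ {X = X} Xv) (─-∪-｛｝ {X = X} Xv) ⟩
    arcs G ((X ─ v) ∪ ｛ v ｝)
      ≡⟨ arcs-∪ (X ─ v) ｛ v ｝ (─-disjoint-｛｝ X v) ⟩
    arcs G (X ─ v) + 2 * between G (X ─ v) ｛ v ｝ + arcs G ｛ v ｝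
      ≡⟨ cong₂ (λ b c → arcs G (X ─ v) + 2 * b + c)
               (trans (between-comm (X ─ v) ｛ v ｝) (between-｛｝ˡ G v (X ─ v)))
               (trans (between-｛｝ˡ G v ｛ v ｝) (nbrs-｛｝-self v)) ⟩
    arcs G (X ─ v) + 2 * nbrs G (X ─ v) v + 0
      ≡⟨ +-identityʳ _ ⟩
    arcs G (X ─ v) + 2 * nbrs G (X ─ v) v ∎
    where open ≡-Reasoning

-- Forests are pseudoforests

Linked-++⁻ˡ : ∀ {A : Set} {R : A → A → Set} xs {ys} → Linked R (xs ++ ys) → Linked R xs
Linked-++⁻ˡ []           _              = []
Linked-++⁻ˡ (x ∷ [])     _              = [-]
Linked-++⁻ˡ (x ∷ y ∷ xs) (Rxy ∷ linked) = Rxy ∷ Linked-++⁻ˡ (y ∷ xs) linked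

Unique-++-∷⁻ : ∀ {A : Set} xs {w : A} ys → Unique (xs ++ w ∷ ys) → Unique (w ∷ xs)
Unique-++-∷⁻ []       ys _               = [] ∷ []
Unique-++-∷⁻ (x ∷ xs) {w} ys (x≢rest ∷ uniq) with Unique-++-∷⁻ xs ys uniq
... | w≢xs ∷ uniq-xs = (w≢x ∷ w≢xs) ∷ (All.++⁻ˡ xs x≢rest ∷ uniq-xs)
  where
  w≢x : w ≢ x
  w≢x w≡x with All.++⁻ʳ xs x≢rest
  ... | x≢w ∷ _ = x≢w (sym w≡x)

module Paths {n : ℕ} {G : Graph n} (wf : WellFormed G) (acyclic : ∀ v vs → ¬ IsCycle G v vs)
             (X : Fin n → Bool) (X⊆alive : X ⊆ alive G)
             (branching : ∀ v → X v ≡ true → 2 ≤ nbrs G X v) where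

  open WellFormedGraph wf
  open import Data.List.Membership.DecPropositional (_≟_ {n}) using (_∈?_)

  Path : List (Fin n) → Set
  Path p = Unique p × Linked (λ u w → adj G u w ≡ true) p × All (λ u → X u ≡ true) p

  Unvisited : List (Fin n) → Fin n → Bool
  Unvisited p z = not ⌊ z ∈? p ⌋

  unvisited-∷ : ∀ {w p} → w ∉ p → suc (card (Unvisited (w ∷ p))) ≤ card (Unvisited p)
  unvisited-∷ {w} {p} w∉p = begin
    suc (card (Unvisited (w ∷ p)))  ≤⟨ s≤s (card-mono shrinks) ⟩
    suc (card (Unvisited p ─ w))    ≡⟨ card-remove {X = Unvisited p} w-unvisited ⟨
    card (Unvisited p)              ∎
    where
    open ≤-Reasoning
    w-unvisited : Unvisited p w ≡ true
    w-unvisited with w ∈? p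
    ... | yes w∈p = ⊥-elim (w∉p w∈p)
    ... | no  _   = refl
    shrinks : Unvisited (w ∷ p) ⊆ (Unvisited p ─ w)
    shrinks z z-new with not⌊⌋⇒¬ (z ∈? (w ∷ p)) z-new | w ≟ z | z ∈? p
    ... | _   | no _     | no _    = refl
    ... | z∉  | yes refl | _       = ⊥-elim (z∉ (here refl))
    ... | z∉  | no _     | yes z∈p = ⊥-elim (z∉ (there z∈p))

  closing-cycle : ∀ {x y} pre {w} post → Path (x ∷ y ∷ pre ++ w ∷ post) →
                  adj G x w ≡ true → IsCycle G w (x ∷ y ∷ pre)
  closing-cycle {x} {y} pre {w} post (uniq , linked , inX) x~w =
    s≤s (s≤s z≤n) ,
    Unique-++-∷⁻ (x ∷ y ∷ pre) post uniq ,
    All.map (λ {z} → X⊆alive z) (All.head (All.++⁻ʳ (x ∷ y ∷ pre) inX) ∷ All.++⁻ˡ (x ∷ y ∷ pre) inX) ,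
    adj-sym x~w ∷ Linked-++⁻ˡ (x ∷ y ∷ pre ++ [ w ])
                    (subst (Linked _) (sym (++-assoc (x ∷ y ∷ pre) [ w ] post)) linked)

  -- The walk never steps back, so it either closes a cycle or reaches an unvisited vertex.
  no-long-path : ∀ k x y p → Path (x ∷ y ∷ p) → card (Unvisited (x ∷ y ∷ p)) ≤ k → ⊥
  no-long-path k x y p path@(uniq , linked , Xx ∷ inX) unvisited≤k
    with card≥2⇒∃≢ (branching x Xx) y
  ... | w , Xw∧x~w , w≢y with ∧-true {X w} Xw∧x~w | w ∈? (x ∷ y ∷ p)
  ...   | _  , x~w | yes (here refl) = case trans (sym x~w) (adj-irrefl x) of λ ()
  ...   | _  , _   | yes (there (here w≡y)) = w≢y w≡y
  ...   | _  , x~w | yes (there (there w∈p)) with ∈-∃++ w∈p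
  ...     | pre , post , refl = acyclic w (x ∷ y ∷ pre) (closing-cycle pre post path x~w)
  no-long-path k x y p path@(uniq , linked , Xx ∷ inX) unvisited≤k
    | w , _ , _ | Xw , x~w | no w∉path with k | ≤-trans (unvisited-∷ w∉path) unvisited≤k
  ... | zero  | ()
  ... | suc k | shorter =
    no-long-path k w x (y ∷ p)
      (All.¬Any⇒All¬ _ w∉path ∷ uniq , adj-sym x~w ∷ linked , Xw ∷ Xx ∷ inX)
      (s≤s⁻¹ shorter)

  no-branching : 1 ≤ card X → ⊥
  no-branching 1≤card with card>0⇒nonempty 1≤card
  ... | v , Xv with card≥2⇒∃≢ (branching v Xv) v
  ...   | w , Xw∧v~w , w≢v with ∧-true {X w} Xw∧v~w
  ...     | Xw , v~w =
    no-long-path _ w v [] ((w≢v ∷ []) ∷ [] ∷ [] , adj-sym v~w ∷ [-] , Xw ∷ Xv ∷ []) ≤-refl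

module _ {n : ℕ} {G : Graph n} (forest : IsForest G) where

  open WellFormedGraph (proj₁ forest)

  forest-leaf : ∀ {X} → X ⊆ alive G → 1 ≤ card X → ∃ λ v → X v ≡ true × nbrs G X v ≤ 1
  forest-leaf {X} X⊆alive 1≤card with Fin.any? (λ v → (X v Bool.≟ true) ×-dec (nbrs G X v ≤? 1))
  ... | yes leaf    = leaf
  ... | no  no-leaf = ⊥-elim (Paths.no-branching (proj₁ forest) (proj₂ forest) X X⊆alive branching 1≤card)
    where
    branching : ∀ v → X v ≡ true → 2 ≤ nbrs G X v
    branching v Xv = ≰⇒> (λ ≤1 → no-leaf (v , Xv , ≤1))

  forest⇒pseudoforest : Pseudoforest G
  forest⇒pseudoforest X X⊆alive = arcs≤ (card X) refl X⊆alive
    where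
    arcs≤ : ∀ m {X} → card X ≡ m → X ⊆ alive G → arcs G X ≤ 2 * m
    arcs≤ zero {X} card≡0 _ = subst (λ c → arcs G X ≤ c * c) card≡0 (between≤card*card G X X)
    arcs≤ (suc m) {X} card≡ X⊆alive
      with v , Xv , leaf ← forest-leaf X⊆alive (subst (1 ≤_) (sym card≡) (s≤s z≤n)) = begin
      arcs G X                          ≡⟨ arcs-remove Xv ⟩
      arcs G X₀ + 2 * nbrs G X₀ v       ≤⟨ +-mono-≤ (arcs≤ m card₀ X₀⊆alive) (*-monoʳ-≤ 2 nbrs₀≤1) ⟩
      2 * m + 2 * 1                     ≡⟨ *-distribˡ-+ 2 m 1 ⟨
      2 * (m + 1)                       ≡⟨ cong (2 *_) (+-comm m 1) ⟩
      2 * suc m                         ∎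
      where
      open ≤-Reasoning
      X₀ = X ─ v
      X₀⊆X : X₀ ⊆ X
      X₀⊆X u = proj₂ ∘ ∧-true
      card₀ : card X₀ ≡ m
      card₀ = suc-injective (trans (sym (card-remove {X = X} Xv)) card≡)
      X₀⊆alive : X₀ ⊆ alive G
      X₀⊆alive u = X⊆alive u ∘ X₀⊆X u
      nbrs₀≤1 : nbrs G X₀ v ≤ 1
      nbrs₀≤1 = ≤-trans (nbrs-mono G v (λ w _ → X₀⊆X w)) leaf

-- One round of contraction

-- N, I: non-isolated and isolated vertices, D: their degree sum, C: vertices of degree one or two,
-- s: size of the independent set, N′: vertices surviving the round.
shrink-arithmetic : ∀ N I D C s N′ → D ≤ 2 * N → 3 * (N + I) ≤ D + 3 * I + 2 * C → C ≤ 3 * s →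
                    N′ + s + I ≤ N + I → 6 * N′ ≤ 5 * (N + I)
shrink-arithmetic N I D C s N′ D≤2N 3V≤D+3I+2C C≤3s N′+s+I≤V = begin
  6 * N′     ≤⟨ +-cancelʳ-≤ (6 * s) (6 * N′) (5 * N) 6N′+6s≤5N+6s ⟩
  5 * N      ≤⟨ *-monoʳ-≤ 5 (m≤m+n N I) ⟩
  5 * (N + I) ∎
  where
  open ≤-Reasoning
  regroup : ∀ N I → N + (2 * N + 3 * I) ≡ 3 * (N + I)
  regroup = solve-∀
  N≤2C : N ≤ 2 * C
  N≤2C = +-cancelʳ-≤ (2 * N + 3 * I) N (2 * C) (begin
    N + (2 * N + 3 * I)    ≡⟨ regroup N I ⟩
    3 * (N + I)            ≤⟨ 3V≤D+3I+2C ⟩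
    D + 3 * I + 2 * C      ≤⟨ +-monoˡ-≤ (2 * C) (+-monoˡ-≤ (3 * I) D≤2N) ⟩
    2 * N + 3 * I + 2 * C  ≡⟨ +-comm (2 * N + 3 * I) (2 * C) ⟩
    2 * C + (2 * N + 3 * I) ∎)
  6N′+6s≤5N+6s : 6 * N′ + 6 * s ≤ 5 * N + 6 * s
  6N′+6s≤5N+6s = begin
    6 * N′ + 6 * s  ≡⟨ *-distribˡ-+ 6 N′ s ⟨
    6 * (N′ + s)    ≤⟨ *-monoʳ-≤ 6 (+-cancelʳ-≤ I (N′ + s) N N′+s+I≤V) ⟩
    6 * N           ≡⟨ +-comm N (5 * N) ⟩
    5 * N + N       ≤⟨ +-monoʳ-≤ (5 * N) (≤-trans N≤2C (*-monoʳ-≤ 2 C≤3s)) ⟩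
    5 * N + 2 * (3 * s) ≡⟨ cong (5 * N +_) (*-assoc 2 3 s) ⟨
    5 * N + 6 * s   ∎

candidate⇒nonIsolated : ∀ {n} {G : Graph n} v → Candidate G v ≡ true → NonIsolated G v ≡ true
candidate⇒nonIsolated {G = G} v cand with ∧-true {alive G v} cand
... | alive-v , deg1∨2 rewrite alive-v = cong not (nonzero (deg G v) deg1∨2)
  where
  nonzero : ∀ d → ((d ≡ᵇ 1) ∨ (d ≡ᵇ 2)) ≡ true → (d ≡ᵇ 0) ≡ false
  nonzero (suc d) _ = refl

three≤deg+isolated+candidate : ∀ d → 3 ≤ d + 3 * χ (d ≡ᵇ 0) + 2 * χ ((d ≡ᵇ 1) ∨ (d ≡ᵇ 2))
three≤deg+isolated+candidate 0                   = ≤-refl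
three≤deg+isolated+candidate 1                   = ≤-refl
three≤deg+isolated+candidate 2                   = s≤s (s≤s (s≤s z≤n))
three≤deg+isolated+candidate (suc (suc (suc d))) = s≤s (s≤s (s≤s z≤n))

module RoundCount {n : ℕ} {G : Graph n} (wf : WellFormed G) (S : Fin n → Bool) (mis : IsMIS G S) where

  open WellFormedGraph wf

  S⇒candidate : ∀ v → S v ≡ true → Candidate G v ≡ true
  S⇒candidate = proj₁ mis

  alive-split : card (alive G) ≡ card (NonIsolated G) + card (Isolated G)
  alive-split = trans (sum-cong-≗ (λ v → cong χ (split (alive G v) (deg G v ≡ᵇ 0))))
                      (card-∪ (NonIsolated G) (Isolated G) (λ v → disjoint (alive G v) (deg G v ≡ᵇ 0)))
    where
    split : ∀ a z → a ≡ (a ∧ not z) ∨ (a ∧ z)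
    split true  true  = refl
    split true  false = refl
    split false z     = refl
    disjoint : ∀ a z → (a ∧ not z) ∧ (a ∧ z) ≡ false
    disjoint true  true  = refl
    disjoint true  false = refl
    disjoint false z     = refl

  deg≤active-nbrs : ∀ v → alive G v ≡ true → deg G v ≤ χ (NonIsolated G v) * nbrs G (NonIsolated G) v
  deg≤active-nbrs v alive-v with deg G v ≡ᵇ 0 in isolated
  ... | true  = ≤-trans (≤-reflexive (≡ᵇ-true⇒≡ isolated)) z≤n
  ... | false rewrite alive-v = begin
    deg G v                           ≡⟨ deg≡nbrs-alive G v ⟩
    nbrs G (alive G) v                ≤⟨ nbrs-mono G v (λ w v~w _ → adj⇒nonIsolated v~w) ⟩
    nbrs G (NonIsolated G) v          ≡⟨ +-identityʳ _ ⟨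
    1 * nbrs G (NonIsolated G) v      ∎
    where open ≤-Reasoning

  low-degree : 3 * card (alive G) ≤ arcs G (NonIsolated G) + 3 * card (Isolated G) + 2 * card (Candidate G)
  low-degree = begin
    3 * card (alive G)
      ≡⟨ *-distribˡ-sum 3 (χ ∘ alive G) ⟩
    ∑[ v < n ] (3 * χ (alive G v))
      ≤⟨ sum-mono-≤ pointwise ⟩
    ∑[ v < n ] (active v + 3 * χ (Isolated G v) + 2 * χ (Candidate G v))
      ≡⟨ ∑-distrib-+ (λ v → active v + 3 * χ (Isolated G v)) (λ v → 2 * χ (Candidate G v)) ⟩
    ∑[ v < n ] (active v + 3 * χ (Isolated G v)) + ∑[ v < n ] (2 * χ (Candidate G v))
      ≡⟨ cong (_+ ∑[ v < n ] (2 * χ (Candidate G v))) (∑-distrib-+ active (λ v → 3 * χ (Isolated G v))) ⟩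
    arcs G (NonIsolated G) + ∑[ v < n ] (3 * χ (Isolated G v)) + ∑[ v < n ] (2 * χ (Candidate G v))
      ≡⟨ cong₂ (λ x y → arcs G (NonIsolated G) + x + y)
               (*-distribˡ-sum 3 (χ ∘ Isolated G)) (*-distribˡ-sum 2 (χ ∘ Candidate G)) ⟨
    arcs G (NonIsolated G) + 3 * card (Isolated G) + 2 * card (Candidate G) ∎
    where
    open ≤-Reasoning
    active : Fin n → ℕ
    active v = χ (NonIsolated G v) * nbrs G (NonIsolated G) v
    pointwise : ∀ v → 3 * χ (alive G v) ≤ active v + 3 * χ (Isolated G v) + 2 * χ (Candidate G v)
    pointwise v with alive G v | deg≤active-nbrs v
    ... | false | _    = z≤n
    ... | true  | deg≤ = ≤-trans (three≤deg+isolated+candidate (deg G v))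
                                 (+-monoˡ-≤ _ (+-monoˡ-≤ _ (deg≤ refl)))

  candidates≤ : card (Candidate G) ≤ 3 * card S
  candidates≤ = begin
    card (Candidate G)                                   ≤⟨ sum-mono-≤ dominated ⟩
    ∑[ v < n ] (χ (S v) + χ (alive G v) * nbrs G S v)    ≡⟨ ∑-distrib-+ (χ ∘ S) (λ v → χ (alive G v) * nbrs G S v) ⟩
    card S + between G (alive G) S                       ≡⟨ cong (card S +_) (between-comm (alive G) S) ⟩
    card S + between G S (alive G)                       ≤⟨ +-monoʳ-≤ (card S) (between-bounded G 2 S-deg≤2) ⟩
    card S + 2 * card S                                  ∎
    where
    open ≤-Reasoning
    dominated : ∀ v → χ (Candidate G v) ≤ χ (S v) + χ (alive G v) * nbrs G S v
    dominated v with Candidate G v in cand | S v in Sv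
    ... | false | _     = z≤n
    ... | true  | true  = s≤s z≤n
    ... | true  | false with u , Su , v~u ← proj₂ (proj₂ mis) v cand Sv
                        rewrite proj₁ (∧-true {alive G v} cand) = ≤-trans 1≤nbrs (m≤m+n _ 0)
      where
      u-counted : χ (S u ∧ adj G v u) ≡ 1
      u-counted rewrite Su | v~u = refl
      1≤nbrs : 1 ≤ nbrs G S v
      1≤nbrs = subst (_≤ nbrs G S v) u-counted (term≤sum (λ w → χ (S w ∧ adj G v w)) u)
    S-deg≤2 : ∀ u → S u ≡ true → nbrs G (alive G) u ≤ 2
    S-deg≤2 u Su = subst (_≤ 2) (deg≡nbrs-alive G u) (deg≤2 (deg G u) (proj₂ (∧-true (S⇒candidate u Su))))
      where
      deg≤2 : ∀ d → ((d ≡ᵇ 1) ∨ (d ≡ᵇ 2)) ≡ true → d ≤ 2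
      deg≤2 1 _ = s≤s z≤n
      deg≤2 2 _ = ≤-refl

  survivors : card (alive (contract G S)) + card S + card (Isolated G) ≤ card (alive G)
  survivors = begin
    card (alive (contract G S)) + card S + card (Isolated G)
      ≡⟨ cong (_+ card (Isolated G)) (∑-distrib-+ (χ ∘ alive (contract G S)) (χ ∘ S)) ⟨
    ∑[ v < n ] (χ (alive (contract G S) v) + χ (S v)) + card (Isolated G)
      ≡⟨ ∑-distrib-+ (λ v → χ (alive (contract G S) v) + χ (S v)) (χ ∘ Isolated G) ⟨
    ∑[ v < n ] (χ (alive (contract G S) v) + χ (S v) + χ (Isolated G v))
      ≤⟨ sum-mono-≤ (λ v → partition (alive G v) (S v) (deg G v ≡ᵇ 0)
                                      (candidate⇒nonIsolated {G = G} v ∘ S⇒candidate v)) ⟩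
    card (alive G) ∎
    where
    open ≤-Reasoning
    partition : ∀ a s z → (s ≡ true → a ∧ not z ≡ true) →
                χ (a ∧ not s ∧ not z) + χ s + χ (a ∧ z) ≤ χ a
    partition true  false z     _ with z
    ... | true  = ≤-refl
    ... | false = ≤-refl
    partition true  true  false _ = ≤-refl
    partition true  true  true  h = case h refl of λ ()
    partition false false z     _ = z≤n
    partition false true  z     h = case h refl of λ ()

  size-contract : Pseudoforest G → 6 * card (alive (contract G S)) ≤ 5 * card (alive G)
  size-contract pseudoforest = subst (λ V → 6 * N′ ≤ 5 * V) (sym alive-split)
    (shrink-arithmetic N I (arcs G (NonIsolated G)) (card (Candidate G)) (card S) N′
      (pseudoforest (NonIsolated G) (λ v → proj₁ ∘ ∧-true))
      (subst (λ V → 3 * V ≤ arcs G (NonIsolated G) + 3 * I + 2 * card (Candidate G)) alive-split low-degree)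
      candidates≤
      (subst (N′ + card S + I ≤_) alive-split survivors))
    where
    N = card (NonIsolated G)
    I = card (Isolated G)
    N′ = card (alive (contract G S))

module RoundInvariant {n : ℕ} {G : Graph n} (wf : WellFormed G) (S : Fin n → Bool) where

  open WellFormedGraph wf

  private
    G′ : Graph n
    G′ = contract G S

  contract-wellFormed : WellFormed G′
  contract-wellFormed = (λ u w → trans (sym (adj′-comm u w))) , adj′-irrefl , (λ u w → proj₁ ∘ ∧-true)
    where
    ∧-swap : ∀ a b c → a ∧ b ∧ c ≡ b ∧ a ∧ c
    ∧-swap true  b     c = refl
    ∧-swap false true  c = refl
    ∧-swap false false c = refl
    adj′-comm : ∀ u w → adj G′ u w ≡ adj G′ w u
    adj′-comm u w = trans
      (cong (λ c → alive G′ u ∧ alive G′ w ∧ c)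
        (cong₂ _∨_ (adj-comm u w)
          (cong₂ _∧_ (cong not (⌊≟⌋-sym u w))
            (cong or (map-cong (λ v → cong (λ c → S v ∧ (deg G v ≡ᵇ 2) ∧ c)
                                           (Bool.∧-comm (adj G v u) (adj G v w)))
                               (allFin n))))))
      (∧-swap (alive G′ u) (alive G′ w) _)
    adj′-irrefl : ∀ u → adj G′ u u ≡ false
    adj′-irrefl u rewrite adj-irrefl u with u ≟ u
    ... | yes _   = trans (cong (alive G′ u ∧_) (Bool.∧-zeroʳ (alive G′ u))) (Bool.∧-zeroʳ (alive G′ u))
    ... | no  u≢u = ⊥-elim (u≢u refl)

  new-arc-witness : ∀ {u w} → adj G′ u w ≡ true → adj G u w ≡ false →
                    u ≢ w × ∃ λ s → S s ≡ true × (deg G s ≡ᵇ 2) ≡ true × adj G s u ≡ true × adj G s w ≡ true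
  new-arc-witness {u} {w} u~′w not-u~w
    with ∧-true {alive G′ u} u~′w
  ... | _ , rest with ∧-true {alive G′ w} rest
  ... | _ , old∨new rewrite not-u~w with ∧-true {not ⌊ u ≟ w ⌋} old∨new
  ... | u≠w , compressed with s , Ps ← any-witness _ (allFin n) compressed
                         with ∧-true {S s} Ps
  ... | Ss , rest₂ with ∧-true {deg G s ≡ᵇ 2} rest₂
  ... | deg2 , s~u∧s~w with ∧-true {adj G s u} s~u∧s~w
  ... | s~u , s~w = not⌊⌋⇒¬ (u ≟ w) u≠w , s , Ss , deg2 , s~u , s~w

  module _ (mis : IsMIS G S) (X′ : Fin n → Bool) (X′⊆alive′ : X′ ⊆ alive G′) where

    X′⊆alive : X′ ⊆ alive G
    X′⊆alive v = proj₁ ∘ ∧-true ∘ X′⊆alive′ v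

    X′∩S=∅ : ∀ v → X′ v ≡ true → S v ≡ false
    X′∩S=∅ v X′v = Bool.not-injective (proj₁ (∧-true {not (S v)} (proj₂ (∧-true {alive G v} (X′⊆alive′ v X′v)))))

    -- The compressed vertices with both neighbours in X′: together with X′ they span every new edge.
    T : Fin n → Bool
    T s = S s ∧ (nbrs G X′ s ≡ᵇ 2)

    T-nbrs : ∀ s → T s ≡ true → nbrs G X′ s ≡ 2
    T-nbrs s Ts = ≡ᵇ-true⇒≡ (proj₂ (∧-true {S s} Ts))

    X′∩T=∅ : Disjoint X′ T
    X′∩T=∅ v with X′ v in X′v
    ... | false = refl
    ... | true rewrite X′∩S=∅ v X′v = refl

    X′∪T⊆alive : (X′ ∪ T) ⊆ alive G
    X′∪T⊆alive v X′∪Tv with X′ v in X′v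
    ... | true  = X′⊆alive v X′v
    ... | false = proj₁ (∧-true (proj₁ mis v (proj₁ (∧-true X′∪Tv))))

    compressed⇒T : ∀ {u w s} → X′ u ≡ true → X′ w ≡ true → u ≢ w → S s ≡ true → (deg G s ≡ᵇ 2) ≡ true →
                   adj G s u ≡ true → adj G s w ≡ true → T s ≡ true
    compressed⇒T {u} {w} {s} X′u X′w u≢w Ss deg2 s~u s~w rewrite Ss = ≡⇒≡ᵇ-true (≤-antisym nbrs≤2 2≤nbrs)
      where
      counted : ∀ {x} → X′ x ≡ true → adj G s x ≡ true → χ (X′ x ∧ adj G s x) ≡ 1
      counted X′x s~x rewrite X′x | s~x = refl
      2≤nbrs : 2 ≤ nbrs G X′ s
      2≤nbrs = subst (_≤ nbrs G X′ s) (cong₂ _+_ (counted X′u s~u) (counted X′w s~w))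
                     (two-terms≤sum (λ x → χ (X′ x ∧ adj G s x)) u≢w)
      nbrs≤2 : nbrs G X′ s ≤ 2
      nbrs≤2 = ≤-trans (nbrs-mono G s (λ x _ → X′⊆alive x))
                       (≤-reflexive (trans (sym (deg≡nbrs-alive G s)) (≡ᵇ-true⇒≡ deg2)))

    Nbhd : Fin n → Fin n → Bool
    Nbhd s w = X′ w ∧ adj G s w

    -- A new edge uw of G′ is charged to the compressed vertex s it came from, and s ∈ T.
    charge : Fin n → Fin n → Fin n → ℕ
    charge u s w = χ (T s ∧ adj G u s) * χ ((Nbhd s ─ u) w)

    edge-charged : ∀ {u} w → X′ u ≡ true →
                   χ (X′ w ∧ adj G′ u w) ≤ χ (X′ w ∧ adj G u w) + ∑[ s < n ] charge u s w
    edge-charged {u} w X′u with X′ w ∧ adj G′ u w in X′w∧u~′w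
    ... | false = z≤n
    ... | true with ∧-true {X′ w} X′w∧u~′w | adj G u w in u~w
    ...   | X′w , _    | true rewrite X′w = m≤m+n 1 _
    ...   | X′w , u~′w | false
            with u≢w , s , Ss , deg2 , s~u , s~w ← new-arc-witness u~′w u~w =
            ≤-trans (≤-trans (≤-reflexive (sym charged)) (term≤sum (λ s → charge u s w) s)) (m≤n+m _ _)
      where
      charged : charge u s w ≡ 1
      charged rewrite compressed⇒T X′u X′w u≢w Ss deg2 s~u s~w | adj-sym s~u
                    | ¬⇒not⌊⌋ (u ≟ w) u≢w | X′w | s~w = refl

    charges≤1 : ∀ {u} s → X′ u ≡ true → T s ∧ adj G u s ≡ true → card (Nbhd s ─ u) ≤ 1
    charges≤1 {u} s X′u T∧u~s with ∧-true {T s} T∧u~s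
    ... | Ts , u~s = s≤s⁻¹ (≤-reflexive (trans (sym (card-remove {X = Nbhd s} u∈Nbhd)) (T-nbrs s Ts)))
      where
      u∈Nbhd : Nbhd s u ≡ true
      u∈Nbhd rewrite X′u | adj-sym u~s = refl

    new-nbrs : ∀ u → X′ u ≡ true → nbrs G′ X′ u ≤ nbrs G X′ u + nbrs G T u
    new-nbrs u X′u = begin
      ∑[ w < n ] χ (X′ w ∧ adj G′ u w)
        ≤⟨ sum-mono-≤ (λ w → edge-charged w X′u) ⟩
      ∑[ w < n ] (χ (X′ w ∧ adj G u w) + ∑[ s < n ] charge u s w)
        ≡⟨ ∑-distrib-+ (λ w → χ (X′ w ∧ adj G u w)) (λ w → ∑[ s < n ] charge u s w) ⟩
      nbrs G X′ u + ∑[ w < n ] ∑[ s < n ] charge u s w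
        ≡⟨ cong (nbrs G X′ u +_) (∑-comm (λ w s → charge u s w)) ⟩
      nbrs G X′ u + ∑[ s < n ] ∑[ w < n ] charge u s w
        ≡⟨ cong (nbrs G X′ u +_) (sum-cong-≗ λ s → *-distribˡ-sum (χ (T s ∧ adj G u s)) (χ ∘ (Nbhd s ─ u))) ⟨
      nbrs G X′ u + ∑[ s < n ] (χ (T s ∧ adj G u s) * card (Nbhd s ─ u))
        ≤⟨ +-monoʳ-≤ (nbrs G X′ u) (sum-mono-≤ λ s → χ-*-≤ (T s ∧ adj G u s) (charges≤1 s X′u)) ⟩
      nbrs G X′ u + nbrs G T u ∎
      where open ≤-Reasoning

    arcs-contract≤ : arcs G′ X′ ≤ arcs G X′ + between G X′ T
    arcs-contract≤ = begin
      ∑[ u < n ] (χ (X′ u) * nbrs G′ X′ u)                          ≤⟨ sum-mono-≤ row ⟩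
      ∑[ u < n ] (χ (X′ u) * nbrs G X′ u + χ (X′ u) * nbrs G T u)   ≡⟨ ∑-distrib-+ (λ u → χ (X′ u) * nbrs G X′ u) (λ u → χ (X′ u) * nbrs G T u) ⟩
      arcs G X′ + between G X′ T                                    ∎
      where
      open ≤-Reasoning
      row : ∀ u → χ (X′ u) * nbrs G′ X′ u ≤ χ (X′ u) * nbrs G X′ u + χ (X′ u) * nbrs G T u
      row u with X′ u in X′u
      ... | false = z≤n
      ... | true  = ≤-trans (*-monoʳ-≤ 1 (new-nbrs u X′u)) (≤-reflexive (*-distribˡ-+ 1 (nbrs G X′ u) (nbrs G T u)))

    arcs-contract≤2*card : Pseudoforest G → arcs G′ X′ ≤ 2 * card X′
    arcs-contract≤2*card pseudoforest = +-cancelʳ-≤ b (arcs G′ X′) (2 * card X′) (begin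
      arcs G′ X′ + b                 ≤⟨ +-monoˡ-≤ b arcs-contract≤ ⟩
      arcs G X′ + b + b              ≡⟨ +-assoc (arcs G X′) b b ⟩
      arcs G X′ + (b + b)            ≡⟨ cong (λ x → arcs G X′ + (b + x)) (+-identityʳ b) ⟨
      arcs G X′ + 2 * b              ≤⟨ m≤m+n _ (arcs G T) ⟩
      arcs G X′ + 2 * b + arcs G T   ≡⟨ arcs-∪ X′ T X′∩T=∅ ⟨
      arcs G (X′ ∪ T)                ≤⟨ pseudoforest (X′ ∪ T) X′∪T⊆alive ⟩
      2 * card (X′ ∪ T)              ≡⟨ cong (2 *_) (card-∪ X′ T X′∩T=∅) ⟩
      2 * (card X′ + card T)         ≡⟨ *-distribˡ-+ 2 (card X′) (card T) ⟩
      2 * card X′ + 2 * card T       ≡⟨ cong (2 * card X′ +_) b≡2*card ⟨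
      2 * card X′ + b                ∎)
      where
      open ≤-Reasoning
      b = between G X′ T
      b≡2*card : b ≡ 2 * card T
      b≡2*card = trans (between-comm X′ T) (between-regular G 2 T-nbrs)

  contract-pseudoforest : IsMIS G S → Pseudoforest G → Pseudoforest G′
  contract-pseudoforest mis pseudoforest X′ X′⊆alive′ = arcs-contract≤2*card mis X′ X′⊆alive′ pseudoforest

rounds-shrink : ∀ {n k} {G G′ : Graph n} → Rounds k G G′ → WellFormed G → Pseudoforest G →
                6 ^ k * size G′ ≤ 5 ^ k * size G
rounds-shrink done _ _ = ≤-refl
rounds-shrink {k = suc k} {G} {G′} (step S mis rounds) wf pseudoforest = begin
  6 ^ suc k * size G′     ≡⟨ *-assoc 6 (6 ^ k) (size G′) ⟩
  6 * (6 ^ k * size G′)   ≤⟨ *-monoʳ-≤ 6 (rounds-shrink rounds contract-wellFormed (contract-pseudoforest mis pseudoforest)) ⟩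
  6 * (5 ^ k * size G₁)   ≡⟨ *-left-comm 6 (5 ^ k) (size G₁) ⟩
  5 ^ k * (6 * size G₁)   ≤⟨ *-monoʳ-≤ (5 ^ k) one-round ⟩
  5 ^ k * (5 * size G)    ≡⟨ *-left-comm (5 ^ k) 5 (size G) ⟩
  5 * (5 ^ k * size G)    ≡⟨ *-assoc 5 (5 ^ k) (size G) ⟨
  5 ^ suc k * size G      ∎
  where
  open ≤-Reasoning
  open RoundInvariant wf S
  G₁ = contract G S
  *-left-comm : ∀ a b c → a * (b * c) ≡ b * (a * c)
  *-left-comm = solve-∀
  one-round : 6 * size G₁ ≤ 5 * size G
  one-round = subst₂ (λ V₁ V → 6 * V₁ ≤ 5 * V) (sym (cnt≡card (alive G₁))) (sym (cnt≡card (alive G)))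
                     (RoundCount.size-contract wf S mis pseudoforest)

^-cancelʳ-≤ : ∀ a b m .{{_ : NonZero m}} → a ^ m ≤ b ^ m → a ≤ b
^-cancelʳ-≤ a b m aᵐ≤bᵐ with a ≤? b
... | yes a≤b = a≤b
... | no  a≰b = ⊥-elim (<⇒≱ (^-monoˡ-< m (≰⇒> a≰b)) aᵐ≤bᵐ)

log-bound : ∀ {n s} k → 2 ≤ n → n ^ (5 ^ k) ≤ 2 ^ (6 ^ k) → 6 ^ k * s ≤ 5 ^ k * n → n ^ s ≤ 2 ^ n
log-bound {n} {s} k 2≤n n^5^k≤2^6^k 6^ks≤5^kn = ^-cancelʳ-≤ (n ^ s) (2 ^ n) (6 ^ k) {{m^n≢0 6 k}} (begin
  (n ^ s) ^ (6 ^ k)     ≡⟨ ^-*-assoc n s (6 ^ k) ⟩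
  n ^ (s * 6 ^ k)       ≤⟨ ^-monoʳ-≤ n {{n≢0}} (subst (_≤ 5 ^ k * n) (*-comm (6 ^ k) s) 6^ks≤5^kn) ⟩
  n ^ (5 ^ k * n)       ≡⟨ ^-*-assoc n (5 ^ k) n ⟨
  (n ^ (5 ^ k)) ^ n     ≤⟨ ^-monoˡ-≤ n n^5^k≤2^6^k ⟩
  (2 ^ (6 ^ k)) ^ n     ≡⟨ ^-*-assoc 2 (6 ^ k) n ⟩
  2 ^ (6 ^ k * n)       ≡⟨ cong (2 ^_) (*-comm (6 ^ k) n) ⟩
  2 ^ (n * 6 ^ k)       ≡⟨ ^-*-assoc 2 n (6 ^ k) ⟨
  (2 ^ n) ^ (6 ^ k)     ∎)
  where
  open ≤-Reasoning
  n≢0 : NonZero n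
  n≢0 = >-nonZero (≤-trans (s≤s z≤n) 2≤n)

IsCeilLogLog⇒upper : ∀ n k → IsCeilLogLog n k → n ^ (5 ^ k) ≤ 2 ^ (6 ^ k)
IsCeilLogLog⇒upper n zero    upper       = upper
IsCeilLogLog⇒upper n (suc k) (upper , _) = upper

mainTheorem7 : (n : ℕ) → 2 ≤ n → (G : Graph n) → IsForest G →
               (∀ v → alive G v ≡ true) →
               (k : ℕ) → IsCeilLogLog n k →
               (G' : Graph n) → Rounds k G G' →
               AtMostNOverLog (size G') n
mainTheorem7 n 2≤n G forest all-alive k loglog G' rounds =
  log-bound k 2≤n (IsCeilLogLog⇒upper n k loglog)
    (subst (λ V → 6 ^ k * size G' ≤ 5 ^ k * V) size≡n
      (rounds-shrink rounds (proj₁ forest) (forest⇒pseudoforest forest)))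
  where
  size≡n : size G ≡ n
  size≡n = trans (cnt≡card (alive G)) (trans (sum-cong-≗ (cong χ ∘ all-alive)) card-full)
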